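{- Let $t,k$ be positive integers with $t-k\le t/3$ and $t\ge 6r_0$ where $r_0=4t^{1/2}(\log_2 t)^{1/4}$ (this holds in particular when $t\ge2000$). Then for all integers $0\le r\le r_0$ and $s\ge0$, every graph with at most $t-r$ vertices whose largest clique minor has order at most $t-r-s$ contains at most $\binom{t-r-s}{k-r}2^s$ cliques of order $k-r$.
   Context: A clique minor of order $m$ in a graph is a $K_m$-minor, i.e., $K_m$ obtained by deleting vertices and edges and contracting edges. -}

module Defs where

open import Data.Nat using (ℕ; zero; suc; _+_; _*_; _≤_; _^_; _≟_)
open import Data.Nat.Properties using () renaming (_≟_ to _≟ℕ_)
open import Data.Bool using (Bool; true; false)
open import Data.Fin using (Fin)
open import Data.Fin.Properties using (all?) renaming (_≟_ to _≟F_)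
open import Data.Fin.Subset using (Subset; _∈_; ∣_∣)
open import Data.Fin.Subset.Properties using (_∈?_)
open import Data.Vec using (_∷_; [])
open import Data.List using (List; []; _∷_; map; _++_; filter; length)
open import Data.Maybe using (Maybe; just)
open import Data.Product using (Σ; _×_; ∃; ∃-syntax; _,_)
open import Relation.Nullary using (¬_; Dec)
open import Relation.Nullary.Decidable using (_×-dec_; _→-dec_; ¬?)
open import Relation.Binary.PropositionalEquality using (_≡_; _≢_; refl)

record Graph (n : ℕ) : Set where
  field
    adj       : Fin n → Fin n → Bool
    adj-sym   : ∀ u v → adj u v ≡ adj v u
    adj-irr   : ∀ u → adj u u ≡ false

open Graph public

Adj : ∀ {n} → Graph n → Fin n → Fin n → Set
Adj G u v = adj G u v ≡ true

Adj? : ∀ {n} (G : Graph n) u v → Dec (Adj G u v)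
Adj? G u v = Data.Bool._≟_ (adj G u v) true
  where import Data.Bool

data WalkIn {n : ℕ} (G : Graph n) (P : Fin n → Set) : Fin n → Fin n → Set where
  here : ∀ {u} → P u → WalkIn G P u u
  step : ∀ {u w v} → P u → Adj G u w → WalkIn G P w v → WalkIn G P u v

-- A K_m-minor model in G: an assignment of (some) vertices to m branch sets
-- (so branch sets are automatically disjoint), each branch set nonempty and
-- connected (in the subgraph induced by it), and any two distinct branch sets
-- joined by an edge.
record KMinorModel {n : ℕ} (G : Graph n) (m : ℕ) : Set where
  field
    branch    : Fin n → Maybe (Fin m)
    nonempty  : ∀ i → ∃[ u ] branch u ≡ just i
    connected : ∀ i u v → branch u ≡ just i → branch v ≡ just i →
                WalkIn G (λ w → branch w ≡ just i) u v
    joined    : ∀ i j → i ≢ j →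
                ∃[ u ] ∃[ v ] (branch u ≡ just i × branch v ≡ just j × Adj G u v)

HasCliqueMinor : ∀ {n} → Graph n → ℕ → Set
HasCliqueMinor G m = KMinorModel G m

IsClique : ∀ {n} → Graph n → ℕ → Subset n → Set
IsClique {n} G m S =
  ∣ S ∣ ≡ m × (∀ u v → u ∈ S → v ∈ S → u ≢ v → Adj G u v)

IsClique? : ∀ {n} (G : Graph n) m S → Dec (IsClique G m S)
IsClique? G m S =
  (∣ S ∣ ≟ℕ m) ×-dec
  all? (λ u → all? (λ v → (u ∈? S) →-dec ((v ∈? S) →-dec (¬? (u ≟F v) →-dec Adj? G u v))))

allSubsets : (n : ℕ) → List (Subset n)
allSubsets zero    = [] ∷ []
allSubsets (suc n) = map (true ∷_) (allSubsets n) ++ map (false ∷_) (allSubsets n)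

numCliques : ∀ {n} → Graph n → ℕ → ℕ
numCliques {n} G m = length (filter (IsClique? G m) (allSubsets n))

-- A set of vertices W spans at most ∣W∣ C q cliques of order q. If W is
-- complete, it is itself the model of a clique minor, so ∣W∣ is at most the
-- clique-minor bound h. Otherwise W contains a non-edge uv, every clique in W
-- misses u or v, and the count for W is at most the sum of the counts for
-- W - u and W - v. Inducting on the excess d of ∣W∣ over h gives the bound
-- (h C q) 2^d.
module Submission where

open import Defs
open import Function using (_∘_)
open import Data.Nat using (ℕ; zero; suc; _+_; _*_; _∸_; _^_; _≤_; _≤′_; ≤′-refl; ≤′-step; s≤s; s≤s⁻¹)
open import Data.Nat.Properties
open import Data.Nat.Combinatorics using (_C_; nCk+nC[k+1]≡[n+1]C[k+1])
open import Data.Fin using (Fin; zero; suc)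
open import Data.Fin.Properties using (any?) renaming (_≟_ to _≟ᶠ_)
open import Data.Fin.Subset using (Subset; _∈_; _∉_; _⊆_; ∣_∣; ⊤; _-_; inside; outside)
open import Data.Fin.Subset.Properties
  using (_∈?_; _⊆?_; ⊆⊤; ∣⊤∣≡n; drop-∷-⊆; x∈p∧x≢y⇒x∈p-y; x∈p⇒∣p-x∣<∣p∣)
open import Data.Vec as Vec using (_∷_; here; there)
open import Data.List using ([]; _∷_; map; _++_; filter; length)
open import Data.List.Properties using (filter-++; length-++; filter-none)
import Data.List.Relation.Unary.All as All
open import Data.List.Relation.Binary.Sublist.Propositional using (⊆-refl)
open import Data.List.Relation.Binary.Sublist.Heterogeneous.Properties
  using (length-mono-≤; ⊆-filter-Sublist)
open import Data.Maybe as Maybe using (Maybe; just; nothing)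
open import Data.Maybe.Properties using (just-injective)
open import Data.Product using (∃-syntax; _×_; _,_; proj₂)
open import Data.Sum using (_⊎_; inj₁; inj₂)
open import Relation.Nullary using (¬_; yes; no; contradiction)
open import Relation.Nullary.Decidable using (_×-dec_; ¬?; decidable-stable)
open import Relation.Unary using (Decidable)
open import Relation.Unary.Properties using (_∪?_)
open import Relation.Binary.PropositionalEquality
  using (_≡_; _≢_; refl; sym; trans; cong; cong₂; subst; module ≡-Reasoning)

length-filter-mono : ∀ {A : Set} {P Q : A → Set} (P? : Decidable P) (Q? : Decidable Q) →
                     (∀ {x} → P x → Q x) → ∀ xs → length (filter P? xs) ≤ length (filter Q? xs)
length-filter-mono P? Q? P⊆Q xs =
  length-mono-≤ (⊆-filter-Sublist P? Q? (λ { refl → P⊆Q }) (⊆-refl {x = xs}))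

module _ {A : Set} {Q R : A → Set} (Q? : Decidable Q) (R? : Decidable R) where

  length-filter-∪ : ∀ xs → length (filter (Q? ∪? R?) xs) ≤ length (filter Q? xs) + length (filter R? xs)
  length-filter-∪ [] = ≤-refl
  length-filter-∪ (x ∷ xs) with ih ← length-filter-∪ xs | Q? x | R? x
  ... | yes _ | yes _ = s≤s (≤-trans ih (+-monoʳ-≤ _ (n≤1+n _)))
  ... | yes _ | no _  = s≤s ih
  ... | no _  | yes _ = ≤-trans (s≤s ih) (≤-reflexive (sym (+-suc _ _)))
  ... | no _  | no _  = ih

length-filter-map : ∀ {A B : Set} {P : B → Set} (P? : Decidable P) (f : A → B) xs →
                    length (filter P? (map f xs)) ≡ length (filter (P? ∘ f) xs)
length-filter-map P? f [] = refl
length-filter-map P? f (x ∷ xs) with P? (f x)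
... | yes _ = cong suc (length-filter-map P? f xs)
... | no _  = length-filter-map P? f xs

countSubsets : ∀ {n} {P : Subset n → Set} → Decidable P → ℕ
countSubsets {n} P? = length (filter P? (allSubsets n))

countSubsets-mono : ∀ {n} {P Q : Subset n → Set} (P? : Decidable P) (Q? : Decidable Q) →
                    (∀ {S} → P S → Q S) → countSubsets P? ≤ countSubsets Q?
countSubsets-mono {n} P? Q? P⊆Q = length-filter-mono P? Q? P⊆Q (allSubsets n)

countSubsets-⊆∪ : ∀ {n} {P Q R : Subset n → Set} (P? : Decidable P) (Q? : Decidable Q) (R? : Decidable R) →
                  (∀ {S} → P S → Q S ⊎ R S) → countSubsets P? ≤ countSubsets Q? + countSubsets R?
countSubsets-⊆∪ {n} P? Q? R? P⊆Q∪R = ≤-trans (countSubsets-mono P? (Q? ∪? R?) P⊆Q∪R)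
                                              (length-filter-∪ Q? R? (allSubsets n))

countSubsets-empty : ∀ {n} {P : Subset n → Set} (P? : Decidable P) → (∀ S → ¬ P S) → countSubsets P? ≡ 0
countSubsets-empty {n} P? ¬P = cong length (filter-none P? (All.universal ¬P (allSubsets n)))

countSubsets-∷ : ∀ {n} {P : Subset (suc n) → Set} (P? : Decidable P) →
                 countSubsets P? ≡ countSubsets (P? ∘ (inside ∷_)) + countSubsets (P? ∘ (outside ∷_))
countSubsets-∷ {n} P? = begin
  length (filter P? (map (inside ∷_) A ++ map (outside ∷_) A))
    ≡⟨ cong length (filter-++ P? (map (inside ∷_) A) (map (outside ∷_) A)) ⟩
  length (filter P? (map (inside ∷_) A) ++ filter P? (map (outside ∷_) A))
    ≡⟨ length-++ (filter P? (map (inside ∷_) A)) ⟩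
  length (filter P? (map (inside ∷_) A)) + length (filter P? (map (outside ∷_) A))
    ≡⟨ cong₂ _+_ (length-filter-map P? (inside ∷_) A) (length-filter-map P? (outside ∷_) A) ⟩
  countSubsets (P? ∘ (inside ∷_)) + countSubsets (P? ∘ (outside ∷_)) ∎
  where
  open ≡-Reasoning
  A = allSubsets n

nCk≤[1+n]Ck : ∀ n k → n C k ≤ suc n C k
nCk≤[1+n]Ck n zero    = ≤-refl
nCk≤[1+n]Ck n (suc k) = ≤-trans (m≤n+m (n C suc k) (n C k)) (≤-reflexive (nCk+nC[k+1]≡[n+1]C[k+1] n k))

C-monoˡ-≤ : ∀ {m n} k → m ≤ n → m C k ≤ n C k
C-monoˡ-≤ {m} k m≤n = go (≤⇒≤′ m≤n)
  where
  go : ∀ {n} → m ≤′ n → m C k ≤ n C k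
  go ≤′-refl      = ≤-refl
  go (≤′-step m≤n) = ≤-trans (go m≤n) (nCk≤[1+n]Ck _ k)

p⊆q∧x∉p⇒p⊆q-x : ∀ {n} {p q : Subset n} {x} → p ⊆ q → x ∉ p → p ⊆ q - x
p⊆q∧x∉p⇒p⊆q-x p⊆q x∉p y∈p = x∈p∧x≢y⇒x∈p-y (p⊆q y∈p) λ { refl → x∉p y∈p }

SubsetOfSize : ∀ {n} → Subset n → ℕ → Subset n → Set
SubsetOfSize W q S = S ⊆ W × ∣ S ∣ ≡ q

subsetOfSize? : ∀ {n} (W : Subset n) q → Decidable (SubsetOfSize W q)
subsetOfSize? W q S = (S ⊆? W) ×-dec (∣ S ∣ ≟ q)

countSubsets-ofSize≤C : ∀ {n} (W : Subset n) q → countSubsets (subsetOfSize? W q) ≤ ∣ W ∣ C q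
countSubsets-ofSize≤C {zero}  Vec.[] zero    = ≤-refl
countSubsets-ofSize≤C {zero}  Vec.[] (suc q) =
  ≤-reflexive (countSubsets-empty (subsetOfSize? Vec.[] (suc q)) λ { Vec.[] (_ , ()) })
countSubsets-ofSize≤C {suc n} (b ∷ W) q = begin
  countSubsets (subsetOfSize? (b ∷ W) q)
    ≡⟨ countSubsets-∷ (subsetOfSize? (b ∷ W) q) ⟩
  countSubsets (ofSize? (inside ∷_)) + countSubsets (ofSize? (outside ∷_))
    ≤⟨ +-monoʳ-≤ _ (≤-trans (countSubsets-mono (ofSize? (outside ∷_)) (subsetOfSize? W q) drop-outside)
                            (countSubsets-ofSize≤C W q)) ⟩
  countSubsets (ofSize? (inside ∷_)) + ∣ W ∣ C q
    ≤⟨ add-inside b q ⟩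
  ∣ b ∷ W ∣ C q ∎
  where
  open ≤-Reasoning
  ofSize? : (f : Subset n → Subset (suc n)) → Decidable (SubsetOfSize (b ∷ W) q ∘ f)
  ofSize? f = subsetOfSize? (b ∷ W) q ∘ f
  drop-outside : ∀ {S} → SubsetOfSize (b ∷ W) q (outside ∷ S) → SubsetOfSize W q S
  drop-outside (S⊆W , refl) = drop-∷-⊆ S⊆W , refl
  add-inside : ∀ b q → countSubsets (subsetOfSize? (b ∷ W) q ∘ (inside ∷_)) + ∣ W ∣ C q ≤ ∣ b ∷ W ∣ C q
  add-inside outside q = ≤-reflexive (cong (_+ ∣ W ∣ C q)
    (countSubsets-empty (subsetOfSize? (outside ∷ W) q ∘ (inside ∷_))
      λ { S (iS⊆oW , _) → contradiction (iS⊆oW here) λ () }))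
  add-inside inside zero = ≤-reflexive (cong (_+ 1)
    (countSubsets-empty (subsetOfSize? (inside ∷ W) zero ∘ (inside ∷_)) λ { S (_ , ()) }))
  add-inside inside (suc q) = begin
    countSubsets (subsetOfSize? (inside ∷ W) (suc q) ∘ (inside ∷_)) + ∣ W ∣ C suc q
      ≤⟨ +-monoˡ-≤ _ (≤-trans (countSubsets-mono _ (subsetOfSize? W q) drop-inside) (countSubsets-ofSize≤C W q)) ⟩
    ∣ W ∣ C q + ∣ W ∣ C suc q
      ≡⟨ nCk+nC[k+1]≡[n+1]C[k+1] ∣ W ∣ q ⟩
    suc ∣ W ∣ C suc q ∎
    where
    drop-inside : ∀ {S} → SubsetOfSize (inside ∷ W) (suc q) (inside ∷ S) → SubsetOfSize W q S
    drop-inside (S⊆W , eq) = drop-∷-⊆ S⊆W , suc-injective eq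

rank : ∀ {n} (W : Subset n) → Fin n → Maybe (Fin ∣ W ∣)
rank (inside  ∷ W) zero    = just zero
rank (inside  ∷ W) (suc u) = Maybe.map suc (rank W u)
rank (outside ∷ W) zero    = nothing
rank (outside ∷ W) (suc u) = rank W u

map-suc≡just⁻¹ : ∀ {m} (x : Maybe (Fin m)) {i} → Maybe.map suc x ≡ just i → ∃[ j ] (x ≡ just j × i ≡ suc j)
map-suc≡just⁻¹ (just j) refl = j , refl , refl

rank-∈ : ∀ {n} (W : Subset n) u {i} → rank W u ≡ just i → u ∈ W
rank-∈ (inside  ∷ W) zero    _  = here
rank-∈ (inside  ∷ W) (suc u) eq with map-suc≡just⁻¹ (rank W u) eq
... | _ , eq′ , _ = there (rank-∈ W u eq′)
rank-∈ (outside ∷ W) (suc u) eq = there (rank-∈ W u eq)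

rank-injective : ∀ {n} (W : Subset n) u v {i} → rank W u ≡ just i → rank W v ≡ just i → u ≡ v
rank-injective (inside ∷ W) zero zero _ _ = refl
rank-injective (inside ∷ W) zero (suc v) refl eq with map-suc≡just⁻¹ (rank W v) eq
... | _ , _ , ()
rank-injective (inside ∷ W) (suc u) zero eq refl with map-suc≡just⁻¹ (rank W u) eq
... | _ , _ , ()
rank-injective (inside ∷ W) (suc u) (suc v) eq eq′
  with map-suc≡just⁻¹ (rank W u) eq | map-suc≡just⁻¹ (rank W v) eq′
... | _ , equ , refl | _ , eqv , refl = cong suc (rank-injective W u v equ eqv)
rank-injective (outside ∷ W) (suc u) (suc v) eq eq′ = cong suc (rank-injective W u v eq eq′)

rank-surjective : ∀ {n} (W : Subset n) i → ∃[ u ] rank W u ≡ just i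
rank-surjective (inside ∷ W) zero = zero , refl
rank-surjective (inside ∷ W) (suc i) with rank-surjective W i
... | u , eq = suc u , cong (Maybe.map suc) eq
rank-surjective (outside ∷ W) i with rank-surjective W i
... | u , eq = suc u , eq

module _ {n} (G : Graph n) where

  Complete : Subset n → Set
  Complete W = ∀ u v → u ∈ W → v ∈ W → u ≢ v → Adj G u v

  NonEdgeIn : Subset n → Set
  NonEdgeIn W = ∃[ u ] ∃[ v ] (u ∈ W × v ∈ W × u ≢ v × ¬ Adj G u v)

  complete⊎nonEdge : ∀ W → Complete W ⊎ NonEdgeIn W
  complete⊎nonEdge W
    with any? (λ u → any? (λ v → (u ∈? W) ×-dec (v ∈? W) ×-dec ¬? (u ≟ᶠ v) ×-dec ¬? (Adj? G u v)))
  ... | yes nonEdge = inj₂ nonEdge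
  ... | no ¬nonEdge = inj₁ λ u v u∈W v∈W u≢v →
    decidable-stable (Adj? G u v) λ ¬adj → ¬nonEdge (u , v , u∈W , v∈W , u≢v , ¬adj)

  -- Each vertex of a complete set is a branch set on its own.
  complete⇒cliqueMinor : ∀ W → Complete W → HasCliqueMinor G ∣ W ∣
  complete⇒cliqueMinor W complete = record
    { branch    = rank W
    ; nonempty  = rank-surjective W
    ; connected = λ i u v eq eq′ →
        subst (WalkIn G (λ w → rank W w ≡ just i) u) (rank-injective W u v eq eq′) (here eq)
    ; joined    = λ i j i≢j →
        let (u , equ) = rank-surjective W i
            (v , eqv) = rank-surjective W j
        in u , v , equ , eqv ,
           complete u v (rank-∈ W u equ) (rank-∈ W v eqv)
             (λ u≡v → i≢j (just-injective (trans (sym equ) (trans (cong (rank W) u≡v) eqv))))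
    }

  emptyCliqueMinor : HasCliqueMinor G 0
  emptyCliqueMinor = record { branch = λ _ → nothing ; nonempty = λ () ; connected = λ () ; joined = λ () }

  module _ (q : ℕ) where

    CliqueIn : Subset n → Subset n → Set
    CliqueIn W S = IsClique G q S × S ⊆ W

    cliqueIn? : ∀ W → Decidable (CliqueIn W)
    cliqueIn? W S = IsClique? G q S ×-dec (S ⊆? W)

    countCliquesIn : Subset n → ℕ
    countCliquesIn W = countSubsets (cliqueIn? W)

    countCliquesIn≤C : ∀ W → countCliquesIn W ≤ ∣ W ∣ C q
    countCliquesIn≤C W = ≤-trans
      (countSubsets-mono (cliqueIn? W) (subsetOfSize? W q) λ { ((size , _) , S⊆W) → S⊆W , size })
      (countSubsets-ofSize≤C W q)

    countCliquesIn-nonEdge : ∀ {W u v} → u ≢ v → ¬ Adj G u v →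
                             countCliquesIn W ≤ countCliquesIn (W - u) + countCliquesIn (W - v)
    countCliquesIn-nonEdge {W} {u} {v} u≢v ¬adj =
      countSubsets-⊆∪ (cliqueIn? W) (cliqueIn? (W - u)) (cliqueIn? (W - v)) misses-u-or-v
      where
      misses-u-or-v : ∀ {S} → CliqueIn W S → CliqueIn (W - u) S ⊎ CliqueIn (W - v) S
      misses-u-or-v {S} (clique , S⊆W) with u ∈? S | v ∈? S
      ... | no u∉S | _      = inj₁ (clique , p⊆q∧x∉p⇒p⊆q-x S⊆W u∉S)
      ... | yes _  | no v∉S = inj₂ (clique , p⊆q∧x∉p⇒p⊆q-x S⊆W v∉S)
      ... | yes u∈S | yes v∈S = contradiction (proj₂ clique u v u∈S v∈S u≢v) ¬adj

    countCliquesIn-bound : ∀ h → (∀ m → HasCliqueMinor G m → m ≤ h) →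
                           ∀ d W → ∣ W ∣ ≤ h + d → countCliquesIn W ≤ (h C q) * 2 ^ d
    countCliquesIn-bound h minor≤h zero W ∣W∣≤h+0 = begin
      countCliquesIn W ≤⟨ countCliquesIn≤C W ⟩
      ∣ W ∣ C q        ≤⟨ C-monoˡ-≤ q (≤-trans ∣W∣≤h+0 (≤-reflexive (+-identityʳ h))) ⟩
      h C q            ≡⟨ *-identityʳ (h C q) ⟨
      (h C q) * 1        ∎
      where open ≤-Reasoning
    countCliquesIn-bound h minor≤h (suc d) W ∣W∣≤h+1+d with complete⊎nonEdge W
    ... | inj₁ complete = begin
      countCliquesIn W    ≤⟨ countCliquesIn≤C W ⟩
      ∣ W ∣ C q           ≤⟨ C-monoˡ-≤ q (minor≤h ∣ W ∣ (complete⇒cliqueMinor W complete)) ⟩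
      h C q               ≤⟨ m≤m*n (h C q) (2 ^ suc d) {{m^n≢0 2 (suc d)}} ⟩
      (h C q) * 2 ^ suc d   ∎
      where open ≤-Reasoning
    ... | inj₂ (u , v , u∈W , v∈W , u≢v , ¬adj) = begin
      countCliquesIn W                                  ≤⟨ countCliquesIn-nonEdge u≢v ¬adj ⟩
      countCliquesIn (W - u) + countCliquesIn (W - v)   ≤⟨ +-mono-≤ (recurse u∈W) (recurse v∈W) ⟩
      (h C q) * 2 ^ d + (h C q) * 2 ^ d                 ≡⟨ cong (λ x → (h C q) * 2 ^ d + (h C q) * x) (+-identityʳ (2 ^ d)) ⟨
      (h C q) * 2 ^ d + (h C q) * (2 ^ d + 0)           ≡⟨ *-distribˡ-+ (h C q) (2 ^ d) (2 ^ d + 0) ⟨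
      (h C q) * 2 ^ suc d                                 ∎
      where
      open ≤-Reasoning
      recurse : ∀ {x} → x ∈ W → countCliquesIn (W - x) ≤ (h C q) * 2 ^ d
      recurse {x} x∈W = countCliquesIn-bound h minor≤h d (W - x)
        (s≤s⁻¹ (≤-trans (x∈p⇒∣p-x∣<∣p∣ x∈W) (≤-trans ∣W∣≤h+1+d (≤-reflexive (+-suc h d)))))

lemma3p4 : (t k : ℕ) → 1 ≤ t → 1 ≤ k →
    2 * t ≤ 3 * k →
    t ^ (24 ^ 4) ≤ 2 ^ (t ^ 2) →
    (r s : ℕ) →
    2 ^ (r ^ 4) ≤ t ^ (256 * t ^ 2) →
    (n : ℕ) (G : Graph n) →
    n + r ≤ t →
    ((m : ℕ) → HasCliqueMinor G m → m + r + s ≤ t) →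
    numCliques G (k ∸ r) ≤ ((t ∸ r ∸ s) C (k ∸ r)) * 2 ^ s
lemma3p4 t k _ _ _ _ r s _ n G n+r≤t minor+r+s≤t = begin
  numCliques G q       ≤⟨ countSubsets-mono (IsClique? G q) (cliqueIn? G q ⊤) (λ clique → clique , ⊆⊤) ⟩
  countCliquesIn G q ⊤ ≤⟨ countCliquesIn-bound G q h minor≤h s ⊤ ∣⊤∣≤h+s ⟩
  (h C q) * 2 ^ s        ∎
  where
  open ≤-Reasoning
  q = k ∸ r
  h = t ∸ r ∸ s
  minor≤h : ∀ m → HasCliqueMinor G m → m ≤ h
  minor≤h m K = subst (m ≤_) (sym (∸-+-assoc t r s))
    (m+n≤o⇒m≤o∸n m (subst (_≤ t) (+-assoc m r s) (minor+r+s≤t m K)))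
  -- K₀ is a minor of every graph, so r + s ≤ t and the truncated subtractions are exact.
  s≤t∸r : s ≤ t ∸ r
  s≤t∸r = m+n≤o⇒m≤o∸n s (subst (_≤ t) (+-comm r s) (minor+r+s≤t 0 (emptyCliqueMinor G)))
  ∣⊤∣≤h+s : ∣ ⊤ {n} ∣ ≤ h + s
  ∣⊤∣≤h+s = begin
    ∣ ⊤ {n} ∣ ≡⟨ ∣⊤∣≡n n ⟩
    n         ≤⟨ m+n≤o⇒m≤o∸n n n+r≤t ⟩
    t ∸ r     ≡⟨ m∸n+n≡m s≤t∸r ⟨
    h + s     ∎
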